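{- Let $G$ be a graph of order $n$ and let $\Gamma$ be a cycle cover of $G$ containing exactly $k$ vertex-cycles. Then \[ I(G\circ 2K_{1};x)=(1+x)^{n-k}\cdot I(\Gamma(G);x). \]
   Context: All graphs are finite and simple. For a graph $G$, $I(G;x)=\sum_{k\ge0}s_kx^k$ where $s_k$ is the number of independent sets (sets of pairwise non-adjacent vertices) of size $k$. $G\circ 2K_1$ is the graph obtained from $G$ by adding, for each vertex $v$ of $G$, two new non-adjacent vertices joined only to $v$. A cycle cover $\Gamma$ of $G$ is a spanning subgraph of $G$ each connected component of which is a single vertex (a vertex-cycle), a single edge (an edge-cycle), or a cycle on at least $3$ vertices (a proper cycle). The graph $\Gamma(G)$ is obtained from $G$ as follows: for each component $C\in\Gamma$, (i) if $C$ is a vertex-cycle $v$, add two new vertices joined only to $v$; (ii) if $C$ is an edge-cycle $uv$, add two new non-adjacent vertices, each joined to both $u$ and $v$ only; (iii) if $C$ is a proper cycle with vertices $v_1,\dots,v_s$ and edges $v_iv_{i+1}$ ($1\le i\le s-1$) and $v_1v_s$, add $s$ new vertices $w_1,\dots,w_s$, where $w_1$ is joined exactly to $v_s,v_1$ and $w_i$ is joined exactly to $v_{i-1},v_i$ for $2\le i\le s$. -}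

module Defs where

open import Data.Nat using (ℕ; zero; suc; _+_; _*_; _∸_; _≡ᵇ_)
open import Data.Fin using (Fin)
open import Data.Fin.Properties using (_≟_)
open import Data.Bool using (Bool; true; false; _∧_; _∨_; not; if_then_else_)
open import Data.List using (List; []; _∷_; length; map; filter; concat; _++_; upTo; allFin)
open import Data.List.Relation.Binary.Permutation.Propositional using (_↭_)
open import Data.Maybe using (Maybe; just; nothing; maybe)
open import Data.Product using (_×_; _,_)
open import Data.Sum using (_⊎_; inj₁; inj₂)
open import Data.Unit using (⊤)
open import Data.Empty using (⊥)
open import Relation.Nullary.Decidable using (⌊_⌋)
open import Relation.Binary.PropositionalEquality using (_≡_)

-- Finite graphs given by a duplicate-free list of vertices and a
-- Boolean adjacency relation (all constructions below are symmetric).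

record FinGraph : Set₁ where
  field
    V     : Set
    verts : List V
    adj   : V → V → Bool

-- all sublists (= subsets, since vertex lists are duplicate-free)
sublists : {A : Set} → List A → List (List A)
sublists []       = [] ∷ []
sublists (x ∷ xs) = let r = sublists xs in r ++ map (x ∷_) r

noneAdj : {A : Set} → (A → A → Bool) → A → List A → Bool
noneAdj adj x []       = true
noneAdj adj x (y ∷ ys) = not (adj x y) ∧ noneAdj adj x ys

isIndep : {A : Set} → (A → A → Bool) → List A → Bool
isIndep adj []       = true
isIndep adj (x ∷ xs) = noneAdj adj x xs ∧ isIndep adj xs

countB : {A : Set} → (A → Bool) → List A → ℕ
countB p []       = 0
countB p (x ∷ xs) = if p x then suc (countB p xs) else countB p xs

Poly : Set
Poly = ℕ → ℕ

I : FinGraph → Poly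
I G k = countB (λ S → (length S ≡ᵇ k) ∧ isIndep adj S) (sublists verts)
  where open FinGraph G

sumTo : (ℕ → ℕ) → ℕ → ℕ
sumTo f zero    = f zero
sumTo f (suc m) = sumTo f m + f (suc m)

_⊛_ : Poly → Poly → Poly
(p ⊛ q) m = sumTo (λ i → p i * q (m ∸ i)) m

one : Poly
one zero    = 1
one (suc _) = 0

onePlusX : Poly
onePlusX zero          = 1
onePlusX (suc zero)    = 1
onePlusX (suc (suc _)) = 0

_^ᴾ_ : Poly → ℕ → Poly
p ^ᴾ zero  = one
p ^ᴾ suc e = p ⊛ (p ^ᴾ e)

Adj : ℕ → Set
Adj n = Fin n → Fin n → Bool

Symmetric : {n : ℕ} → Adj n → Set
Symmetric adj = ∀ u v → adj u v ≡ adj v u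

Irreflexive : {n : ℕ} → Adj n → Set
Irreflexive adj = ∀ v → adj v v ≡ false

eqF : {n : ℕ} → Fin n → Fin n → Bool
eqF u v = ⌊ u ≟ v ⌋

asGraph : (n : ℕ) → Adj n → FinGraph
asGraph n adj = record { V = Fin n ; verts = allFin n ; adj = adj }

-- G ∘ 2K₁ : new vertices inj₂ (v , i), i ∈ {0,1}, pendant at v
corona2K1 : (n : ℕ) → Adj n → FinGraph
corona2K1 n adj = record
  { V     = Fin n ⊎ (Fin n × ℕ)
  ; verts = map inj₁ (allFin n) ++ concat (map (λ v → inj₂ (v , 0) ∷ inj₂ (v , 1) ∷ []) (allFin n))
  ; adj   = a
  }
  where
  a : Fin n ⊎ (Fin n × ℕ) → Fin n ⊎ (Fin n × ℕ) → Bool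
  a (inj₁ u)       (inj₁ v)       = adj u v
  a (inj₁ u)       (inj₂ (v , _)) = eqF u v
  a (inj₂ (u , _)) (inj₁ v)       = eqF u v
  a (inj₂ _)       (inj₂ _)       = false

-- A cycle cover is a list of components, each given as a
-- list of vertices [v₁,…,v_s]: s = 1 vertex-cycle, s = 2 edge-cycle v₁v₂,
-- s ≥ 3 proper cycle with edges vᵢvᵢ₊₁ and v₁v_s.  The concatenation of
-- the components is a permutation of all vertices (spanning, disjoint).

lastOf : {A : Set} → A → List A → A
lastOf x []       = x
lastOf x (y ∷ ys) = lastOf y ys

PathIn : {n : ℕ} → Adj n → List (Fin n) → Set
PathIn adj (u ∷ v ∷ rest) = (adj u v ≡ true) × PathIn adj (v ∷ rest)
PathIn adj _              = ⊤

IsComponent : {n : ℕ} → Adj n → List (Fin n) → Set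
IsComponent adj []                 = ⊥
IsComponent adj (v ∷ [])           = ⊤
IsComponent adj (u ∷ v ∷ [])       = adj u v ≡ true
IsComponent adj (u ∷ v ∷ w ∷ rest) =
  PathIn adj (u ∷ v ∷ w ∷ rest) × (adj (lastOf w rest) u ≡ true)

data AllComp {n : ℕ} (adj : Adj n) : List (List (Fin n)) → Set where
  []  : AllComp adj []
  _∷_ : ∀ {c cs} → IsComponent adj c → AllComp adj cs → AllComp adj (c ∷ cs)

IsCycleCover : (n : ℕ) → Adj n → List (List (Fin n)) → Set
IsCycleCover n adj cs = AllComp adj cs × (concat cs ↭ allFin n)

vertexCycles : {n : ℕ} → List (List (Fin n)) → ℕ
vertexCycles []               = 0
vertexCycles ((_ ∷ []) ∷ cs)  = suc (vertexCycles cs)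
vertexCycles (_ ∷ cs)         = vertexCycles cs

-- The graph Γ(G).  New vertices are inj₂ (c , j): component number c
-- (0-based), j-th new vertex of it (0-based).

at : {A : Set} → List A → ℕ → Maybe A
at []       _       = nothing
at (x ∷ xs) zero    = just x
at (x ∷ xs) (suc i) = at xs i

newCount : {A : Set} → List A → ℕ
newCount []           = 0
newCount (_ ∷ [])     = 2
newCount (_ ∷ _ ∷ []) = 2
newCount xs           = length xs

isAt : {n : ℕ} → List (Fin n) → ℕ → Fin n → Bool
isAt vs i v = maybe (λ u → eqF u v) false (at vs i)

-- is the j-th new vertex of component vs joined to v ?
attach : {n : ℕ} → List (Fin n) → ℕ → Fin n → Bool
attach []               j v = false
attach (u ∷ [])         j v = eqF u v
attach (u ∷ w ∷ [])     j v = eqF u v ∨ eqF w v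
attach vs@(_ ∷ _ ∷ _ ∷ _) zero    v = isAt vs 0 v ∨ isAt vs (length vs ∸ 1) v
attach vs@(_ ∷ _ ∷ _ ∷ _) (suc j) v = isAt vs (suc j) v ∨ isAt vs j v

newVerts : {n : ℕ} → ℕ → List (List (Fin n)) → List (ℕ × ℕ)
newVerts c []        = []
newVerts c (vs ∷ cs) = map (λ j → (c , j)) (upTo (newCount vs)) ++ newVerts (suc c) cs

attachC : {n : ℕ} → List (List (Fin n)) → ℕ × ℕ → Fin n → Bool
attachC cs (c , j) v = maybe (λ vs → attach vs j v) false (at cs c)

ΓG : (n : ℕ) → Adj n → List (List (Fin n)) → FinGraph
ΓG n adj cs = record
  { V     = Fin n ⊎ (ℕ × ℕ)
  ; verts = map inj₁ (allFin n) ++ map inj₂ (newVerts 0 cs)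
  ; adj   = a
  }
  where
  a : Fin n ⊎ (ℕ × ℕ) → Fin n ⊎ (ℕ × ℕ) → Bool
  a (inj₁ u) (inj₁ v) = adj u v
  a (inj₁ u) (inj₂ w) = attachC cs w u
  a (inj₂ w) (inj₁ v) = attachC cs w v
  a (inj₂ _) (inj₂ _) = false

module Submission where

-- Write a vertex list as  map inj₁ xs ++ map inj₂ E  with the "pendants" E
-- pairwise non-adjacent.  Choosing first the part S ⊆ xs of an independent
-- set and then any pendants not adjacent to S gives
--     I(x) = Σ_{S independent} x^|S| (1+x)^{free(S)},   free(S) = #pendants avoiding S.
-- G∘2K₁ and Γ(G) both have this shape over G, so the theorem follows from
--     free_{G∘2K₁}(S) = (n - k) + free_{Γ(G)}(S)   for every independent S.
-- This is checked per component C of Γ: a vertex v has 2·[v ∉ S] free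
-- pendants in G∘2K₁, whereas C has free_C(S) = #{edges of C with no end in S}
-- free new vertices in Γ(G) (taking a vertex-cycle's "edge" twice).  As an
-- independent S meets each edge at most once, double counting the edges gives
--     Σ_{v∈C} 2·[v ∉ S] = weight(C) + free_C(S),   weight(C) = 0 or |C|.

open import Defs
open import Data.Nat using (ℕ; zero; suc; _+_; _*_; _∸_; _≡ᵇ_)
open import Data.Nat.Properties
  using (+-identityʳ; +-assoc; +-comm; +-suc; *-distribʳ-+; m+n∸n≡m; +-commutativeSemigroup)
open import Data.Nat.ListAction using (sum)
open import Data.Nat.ListAction.Properties using (sum-++; sum-↭)
open import Data.Nat.Solver using (module +-*-Solver)
open import Algebra.Properties.CommutativeSemigroup +-commutativeSemigroup
  using () renaming (interchange to +-interchange)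
open import Data.Bool using (Bool; true; false; _∧_; _∨_; not; if_then_else_)
open import Data.Bool.Properties using (∧-assoc; ∧-comm; ∧-zeroʳ)
open import Data.Bool.ListAction using (all)
open import Data.List using (List; []; _∷_; length; map; concat; _++_; upTo; applyUpTo; allFin)
open import Data.List.Properties using (map-++; map-cong; length-++; map-applyUpTo; length-tabulate)
open import Data.List.Membership.Propositional using (_∈_)
open import Data.List.Relation.Unary.Any using (here; there)
open import Data.List.Relation.Binary.Permutation.Propositional using (_↭_; ↭-sym)
open import Data.List.Relation.Binary.Permutation.Propositional.Properties using (map⁺; ↭-length)
open import Data.Maybe using (Maybe; just; nothing; maybe)
open import Data.Product using (_×_; _,_; proj₁; proj₂)
open import Data.Sum using (_⊎_; inj₁; inj₂)
open import Data.Fin using (Fin)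
open import Data.Fin.Properties using (_≟_)
open import Data.Empty using (⊥; ⊥-elim)
open import Function using (_∘_; id)
open import Relation.Nullary using (yes; no)
open import Relation.Binary.PropositionalEquality
open +-*-Solver using (solve; _:+_; _:=_; con)

private
  variable
    A B : Set

infixl 6 _+ᴾ_

_+ᴾ_ : Poly → Poly → Poly
(p +ᴾ q) m = p m + q m

0ᴾ : Poly
0ᴾ _ = 0

x·_ : Poly → Poly
(x· q) zero    = 0
(x· q) (suc m) = q m

[1+x]·_ : Poly → Poly
[1+x]· q = q +ᴾ x· q

[1+x]^_·_ : ℕ → Poly → Poly
[1+x]^ zero  · q = q
[1+x]^ suc d · q = [1+x]· ([1+x]^ d · q)

x·-cong : ∀ {q q'} → q ≗ q' → x· q ≗ x· q'
x·-cong q≗q' zero    = refl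
x·-cong q≗q' (suc m) = q≗q' m

[1+x]·-cong : ∀ {q q'} → q ≗ q' → [1+x]· q ≗ [1+x]· q'
[1+x]·-cong q≗q' zero    = cong₂ _+_ (q≗q' zero) refl
[1+x]·-cong q≗q' (suc m) = cong₂ _+_ (q≗q' (suc m)) (q≗q' m)

sumTo-cong : ∀ {f g} → f ≗ g → ∀ m → sumTo f m ≡ sumTo g m
sumTo-cong f≗g zero    = f≗g zero
sumTo-cong f≗g (suc m) = cong₂ _+_ (sumTo-cong f≗g m) (f≗g (suc m))

sumTo-+ : ∀ f g m → sumTo (λ i → f i + g i) m ≡ sumTo f m + sumTo g m
sumTo-+ f g zero    = refl
sumTo-+ f g (suc m) = trans (cong (_+ (f (suc m) + g (suc m))) (sumTo-+ f g m))
                            (+-interchange (sumTo f m) (sumTo g m) (f (suc m)) (g (suc m)))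

sumTo-head : ∀ f m → sumTo f (suc m) ≡ f 0 + sumTo (f ∘ suc) m
sumTo-head f zero    = refl
sumTo-head f (suc m) = trans (cong (_+ f (suc (suc m))) (sumTo-head f m))
                             (+-assoc (f 0) (sumTo (f ∘ suc) m) (f (suc (suc m))))

sumTo-only-head : ∀ f → (∀ i → f (suc i) ≡ 0) → ∀ m → sumTo f m ≡ f 0
sumTo-only-head f vanish zero    = refl
sumTo-only-head f vanish (suc m) =
  trans (cong₂ _+_ (sumTo-only-head f vanish m) (vanish m)) (+-identityʳ (f 0))

⊛-congˡ : ∀ {p p'} r → p ≗ p' → (p ⊛ r) ≗ (p' ⊛ r)
⊛-congˡ r p≗p' m = sumTo-cong (λ i → cong (_* r (m ∸ i)) (p≗p' i)) m

one-⊛ : ∀ r → (one ⊛ r) ≗ r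
one-⊛ r m = trans (sumTo-only-head _ (λ _ → refl) m) (+-identityʳ (r m))

1+x-⊛ : ∀ q → (onePlusX ⊛ q) ≗ [1+x]· q
1+x-⊛ q zero    = refl
1+x-⊛ q (suc m) =
  trans (sumTo-head (λ i → onePlusX i * q (suc m ∸ i)) m)
        (cong₂ _+_ (+-identityʳ (q (suc m)))
                   (trans (sumTo-only-head _ (λ _ → refl) m) (+-identityʳ (q m))))

⊛-distribʳ-+ᴾ : ∀ p q r → ((p +ᴾ q) ⊛ r) ≗ ((p ⊛ r) +ᴾ (q ⊛ r))
⊛-distribʳ-+ᴾ p q r m =
  trans (sumTo-cong (λ i → *-distribʳ-+ (r (m ∸ i)) (p i) (q i)) m)
        (sumTo-+ (λ i → p i * r (m ∸ i)) (λ i → q i * r (m ∸ i)) m)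

x·-⊛ : ∀ p r → ((x· p) ⊛ r) ≗ x· (p ⊛ r)
x·-⊛ p r zero    = refl
x·-⊛ p r (suc m) = sumTo-head (λ i → (x· p) i * r (suc m ∸ i)) m

[1+x]·-⊛ : ∀ p r → (([1+x]· p) ⊛ r) ≗ [1+x]· (p ⊛ r)
[1+x]·-⊛ p r m = trans (⊛-distribʳ-+ᴾ p (x· p) r m) (cong ((p ⊛ r) m +_) (x·-⊛ p r m))

power-⊛ : ∀ d r → ((onePlusX ^ᴾ d) ⊛ r) ≗ [1+x]^ d · r
power-⊛ zero    r = one-⊛ r
power-⊛ (suc d) r m =
  begin
    ((onePlusX ⊛ (onePlusX ^ᴾ d)) ⊛ r) m  ≡⟨ ⊛-congˡ r (1+x-⊛ (onePlusX ^ᴾ d)) m ⟩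
    (([1+x]· (onePlusX ^ᴾ d)) ⊛ r) m     ≡⟨ [1+x]·-⊛ (onePlusX ^ᴾ d) r m ⟩
    ([1+x]· ((onePlusX ^ᴾ d) ⊛ r)) m     ≡⟨ [1+x]·-cong (power-⊛ d r) m ⟩
    ([1+x]^ suc d · r) m                 ∎
  where open ≡-Reasoning

[1+x]^-cong : ∀ d {q q'} → q ≗ q' → [1+x]^ d · q ≗ [1+x]^ d · q'
[1+x]^-cong zero    q≗q' = q≗q'
[1+x]^-cong (suc d) q≗q' = [1+x]·-cong ([1+x]^-cong d q≗q')

[1+x]^-+ : ∀ d e q → [1+x]^ (d + e) · q ≗ [1+x]^ d · ([1+x]^ e · q)
[1+x]^-+ zero    e q = λ _ → refl
[1+x]^-+ (suc d) e q = [1+x]·-cong ([1+x]^-+ d e q)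

[1+x]^-+ᴾ : ∀ d p q → [1+x]^ d · (p +ᴾ q) ≗ ([1+x]^ d · p) +ᴾ ([1+x]^ d · q)
[1+x]^-+ᴾ zero    p q = λ _ → refl
[1+x]^-+ᴾ (suc d) p q m =
  trans ([1+x]·-cong ([1+x]^-+ᴾ d p q) m) ([1+x]·-+ᴾ ([1+x]^ d · p) ([1+x]^ d · q) m)
  where
  [1+x]·-+ᴾ : ∀ p q → [1+x]· (p +ᴾ q) ≗ ([1+x]· p) +ᴾ ([1+x]· q)
  [1+x]·-+ᴾ p q zero    = +-interchange (p 0) (q 0) 0 0
  [1+x]·-+ᴾ p q (suc m) = +-interchange (p (suc m)) (q (suc m)) (p m) (q m)

[1+x]^-x· : ∀ d q → [1+x]^ d · (x· q) ≗ x· ([1+x]^ d · q)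
[1+x]^-x· zero    q = λ _ → refl
[1+x]^-x· (suc d) q m = trans ([1+x]·-cong ([1+x]^-x· d q) m) ([1+x]·-x· ([1+x]^ d · q) m)
  where
  [1+x]·-x· : ∀ q → [1+x]· (x· q) ≗ x· ([1+x]· q)
  [1+x]·-x· q zero    = refl
  [1+x]·-x· q (suc m) = refl

[1+x]^-0ᴾ : ∀ d → [1+x]^ d · 0ᴾ ≗ 0ᴾ
[1+x]^-0ᴾ zero    = λ _ → refl
[1+x]^-0ᴾ (suc d) m = trans ([1+x]·-cong ([1+x]^-0ᴾ d) m) ([1+x]·-0ᴾ m)
  where
  [1+x]·-0ᴾ : [1+x]· 0ᴾ ≗ 0ᴾ
  [1+x]·-0ᴾ zero    = refl
  [1+x]·-0ᴾ (suc m) = refl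

bit : Bool → ℕ
bit true  = 1
bit false = 0

sumMap : (A → ℕ) → List A → ℕ
sumMap f xs = sum (map f xs)

sumMap-cong : ∀ {f g : A → ℕ} → f ≗ g → ∀ xs → sumMap f xs ≡ sumMap g xs
sumMap-cong f≗g xs = cong sum (map-cong f≗g xs)

sumMap-++ : ∀ (f : A → ℕ) xs ys → sumMap f (xs ++ ys) ≡ sumMap f xs + sumMap f ys
sumMap-++ f xs ys = trans (cong sum (map-++ f xs ys)) (sum-++ (map f xs) (map f ys))

sumMap-concat : ∀ (f : A → ℕ) xss → sumMap f (concat xss) ≡ sumMap (sumMap f) xss
sumMap-concat f []         = refl
sumMap-concat f (xs ∷ xss) =
  trans (sumMap-++ f xs (concat xss)) (cong (sumMap f xs +_) (sumMap-concat f xss))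

sumMap-↭ : ∀ (f : A → ℕ) {xs ys} → xs ↭ ys → sumMap f xs ≡ sumMap f ys
sumMap-↭ f xs↭ys = sum-↭ (map⁺ f xs↭ys)

countB-++ : ∀ (p : A → Bool) xs ys → countB p (xs ++ ys) ≡ countB p xs + countB p ys
countB-++ p []       ys = refl
countB-++ p (x ∷ xs) ys with p x
... | true  = cong suc (countB-++ p xs ys)
... | false = countB-++ p xs ys

countB-map : ∀ (p : B → Bool) (f : A → B) xs → countB p (map f xs) ≡ countB (p ∘ f) xs
countB-map p f []       = refl
countB-map p f (x ∷ xs) with p (f x)
... | true  = cong suc (countB-map p f xs)
... | false = countB-map p f xs

countB-cong : ∀ {p q : A → Bool} → p ≗ q → ∀ xs → countB p xs ≡ countB q xs
countB-cong {p = p} {q} p≗q []       = refl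
countB-cong {p = p} {q} p≗q (x ∷ xs) with p x | q x | p≗q x
... | true  | true  | refl = cong suc (countB-cong p≗q xs)
... | false | false | refl = countB-cong p≗q xs

countB-none : ∀ {p : A → Bool} → (∀ x → p x ≡ false) → ∀ xs → countB p xs ≡ 0
countB-none {p = p} never []       = refl
countB-none {p = p} never (x ∷ xs) with p x | never x
... | false | refl = countB-none never xs

countB-as-sum : ∀ (p : A → Bool) xs → countB p xs ≡ sumMap (bit ∘ p) xs
countB-as-sum p []       = refl
countB-as-sum p (x ∷ xs) with p x
... | true  = cong suc (countB-as-sum p xs)
... | false = countB-as-sum p xs

countB-concatMap : ∀ (p : B → Bool) (g : A → List B) xs →
                   countB p (concat (map g xs)) ≡ sumMap (countB p ∘ g) xs
countB-concatMap p g []       = refl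
countB-concatMap p g (x ∷ xs) =
  trans (countB-++ p (g x) (concat (map g xs))) (cong (countB p (g x) +_) (countB-concatMap p g xs))

all-cong : ∀ {f g : A → Bool} → f ≗ g → ∀ xs → all f xs ≡ all g xs
all-cong f≗g []       = refl
all-cong f≗g (x ∷ xs) = cong₂ _∧_ (f≗g x) (all-cong f≗g xs)

all-true : ∀ (xs : List A) → all (λ _ → true) xs ≡ true
all-true []       = refl
all-true (x ∷ xs) = all-true xs

all-∧ : ∀ (f g : A → Bool) xs → all (λ y → f y ∧ g y) xs ≡ all f xs ∧ all g xs
all-∧ f g []       = refl
all-∧ f g (x ∷ xs) with f x | g x
... | true  | true  = all-∧ f g xs
... | true  | false = sym (∧-zeroʳ (all f xs))
... | false | _     = refl

all-nor : ∀ (f g : A → Bool) xs →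
          all (λ y → not (f y ∨ g y)) xs ≡ all (not ∘ f) xs ∧ all (not ∘ g) xs
all-nor f g []       = refl
all-nor f g (x ∷ xs) with f x | g x
... | true  | _     = refl
... | false | true  = sym (∧-zeroʳ (all (not ∘ f) xs))
... | false | false = all-nor f g xs

all-∈ : ∀ {f : A → Bool} {y} xs → all f xs ≡ true → y ∈ xs → f y ≡ true
all-∈ {f = f} (x ∷ xs) ok y∈ with f x in fx
all-∈ (x ∷ xs) ok (here refl)  | true = fx
all-∈ (x ∷ xs) ok (there y∈xs) | true = all-∈ xs ok y∈xs
all-∈ (x ∷ xs) () y∈           | false

module Restricted {V : Set} (a : V → V → Bool) where

  -- indPoly p xs counts the independent subsets of xs all of whose members
  -- satisfy p: either x is left out, or x is allowed, taken, and its
  -- neighbours are forbidden from then on.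
  indPoly : (V → Bool) → List V → Poly
  indPoly p []       = one
  indPoly p (x ∷ xs) =
    indPoly p xs +ᴾ (if p x then x· indPoly (λ y → not (a x y) ∧ p y) xs else 0ᴾ)

  noneAdj-as-all : ∀ x S → noneAdj a x S ≡ all (λ y → not (a x y)) S
  noneAdj-as-all x []      = refl
  noneAdj-as-all x (y ∷ S) = cong (not (a x y) ∧_) (noneAdj-as-all x S)

  indOfSize : (V → Bool) → ℕ → List V → Bool
  indOfSize p m S = (length S ≡ᵇ m) ∧ (all p S ∧ isIndep a S)

  indPoly-counts : ∀ p xs m → countB (indOfSize p m) (sublists xs) ≡ indPoly p xs m
  indPoly-counts p []       zero    = refl
  indPoly-counts p []       (suc m) = refl
  indPoly-counts p (x ∷ xs) m =
    trans (countB-++ (indOfSize p m) (sublists xs) (map (x ∷_) (sublists xs)))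
          (cong₂ _+_ (indPoly-counts p xs m)
                     (trans (countB-map (indOfSize p m) (x ∷_) (sublists xs)) (sets-with-x m)))
    where
    sets-with-x : ∀ m → countB (indOfSize p m ∘ (x ∷_)) (sublists xs)
                   ≡ (if p x then x· indPoly (λ y → not (a x y) ∧ p y) xs else 0ᴾ) m
    sets-with-x m with p x
    ... | false = countB-none (λ S → ∧-zeroʳ (suc (length S) ≡ᵇ m)) (sublists xs)
    sets-with-x zero    | true = countB-none (λ S → refl) (sublists xs)
    sets-with-x (suc m) | true =
      trans (countB-cong (λ S → cong ((length S ≡ᵇ m) ∧_) (regroup S)) (sublists xs))
            (indPoly-counts (λ y → not (a x y) ∧ p y) xs m)
      where
      regroup : ∀ S → all p S ∧ (noneAdj a x S ∧ isIndep a S)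
                      ≡ all (λ y → not (a x y) ∧ p y) S ∧ isIndep a S
      regroup S = begin
        all p S ∧ (noneAdj a x S ∧ isIndep a S)
          ≡⟨ sym (∧-assoc (all p S) _ _) ⟩
        (all p S ∧ noneAdj a x S) ∧ isIndep a S
          ≡⟨ cong (_∧ isIndep a S) (∧-comm (all p S) _) ⟩
        (noneAdj a x S ∧ all p S) ∧ isIndep a S
          ≡⟨ cong (λ b → (b ∧ all p S) ∧ isIndep a S) (noneAdj-as-all x S) ⟩
        (all (λ y → not (a x y)) S ∧ all p S) ∧ isIndep a S
          ≡⟨ cong (_∧ isIndep a S) (sym (all-∧ (λ y → not (a x y)) p S)) ⟩
        all (λ y → not (a x y) ∧ p y) S ∧ isIndep a S
          ∎
        where open ≡-Reasoning

I-as-indPoly : ∀ G → I G ≗ Restricted.indPoly (FinGraph.adj G) (λ _ → true) (FinGraph.verts G)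
I-as-indPoly G m =
  trans (countB-cong (λ S → cong (λ b → (length S ≡ᵇ m) ∧ (b ∧ isIndep adj S)) (sym (all-true S)))
                     (sublists verts))
        (indPoly-counts (λ _ → true) verts m)
  where
  open FinGraph G
  open Restricted adj

avoidedBy : (A ⊎ B → A ⊎ B → Bool) → List A → A ⊎ B → Bool
avoidedBy a S y = all (λ s → not (a (inj₁ s) y)) S

data Independent (b : A → A → Bool) : List A → Set where
  []  : Independent b []
  _∷_ : ∀ {x S} → all (λ s → not (b s x)) S ≡ true → Independent b S → Independent b (x ∷ S)

-- Allowed pendants are independent of each other: each one multiplies by (1 + x).
indPoly-pendants : {A B : Set} (a : A ⊎ B → A ⊎ B → Bool) → (∀ w w' → a (inj₂ w) (inj₂ w') ≡ false) →
                   ∀ p E → Restricted.indPoly a p (map inj₂ E) ≗ [1+x]^ countB (p ∘ inj₂) E · one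
indPoly-pendants a pendant p []      m = refl
indPoly-pendants {A} {B} a pendant p (w ∷ E) m with p (inj₂ w)
... | true  = cong₂ _+_ (indPoly-pendants a pendant p E m) (x·-cong taking-w m)
  where
  -- taking w forbids no further pendant
  p' : A ⊎ B → Bool
  p' y = not (a (inj₂ w) y) ∧ p y
  same-count : countB (p' ∘ inj₂) E ≡ countB (p ∘ inj₂) E
  same-count = countB-cong (λ w' → cong (λ b → not b ∧ p (inj₂ w')) (pendant w w')) E
  taking-w : Restricted.indPoly a p' (map inj₂ E) ≗ [1+x]^ countB (p ∘ inj₂) E · one
  taking-w i = trans (indPoly-pendants a pendant p' E i) (cong (λ k → ([1+x]^ k · one) i) same-count)
... | false = trans (+-identityʳ _) (indPoly-pendants a pendant p E m)

module Comparison
  {A Bᶜ Bᵍ : Set} (b : A → A → Bool)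
  (aᶜ : A ⊎ Bᶜ → A ⊎ Bᶜ → Bool) (aᵍ : A ⊎ Bᵍ → A ⊎ Bᵍ → Bool)
  (baseᶜ : ∀ s x → aᶜ (inj₁ s) (inj₁ x) ≡ b s x)
  (baseᵍ : ∀ s x → aᵍ (inj₁ s) (inj₁ x) ≡ b s x)
  (pendantᶜ : ∀ w w' → aᶜ (inj₂ w) (inj₂ w') ≡ false)
  (pendantᵍ : ∀ w w' → aᵍ (inj₂ w) (inj₂ w') ≡ false)
  (d : ℕ) (Eᶜ : List Bᶜ) (Eᵍ : List Bᵍ)
  (balance : ∀ S → Independent b S →
             countB (avoidedBy aᶜ S ∘ inj₂) Eᶜ ≡ d + countB (avoidedBy aᵍ S ∘ inj₂) Eᵍ)
  where

  open Restricted aᶜ using () renaming (indPoly to indPolyᶜ)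
  open Restricted aᵍ using () renaming (indPoly to indPolyᵍ)

  avoidedᶜ-base : ∀ S x → avoidedBy aᶜ S (inj₁ x) ≡ all (λ s → not (b s x)) S
  avoidedᶜ-base S x = all-cong (λ s → cong not (baseᶜ s x)) S

  avoidedᵍ-base : ∀ S x → avoidedBy aᵍ S (inj₁ x) ≡ all (λ s → not (b s x)) S
  avoidedᵍ-base S x = all-cong (λ s → cong not (baseᵍ s x)) S

  -- Induction over the base vertices still to be decided; S holds those taken.
  compare : ∀ xs S → Independent b S →
            indPolyᶜ (avoidedBy aᶜ S) (map inj₁ xs ++ map inj₂ Eᶜ)
            ≗ [1+x]^ d · indPolyᵍ (avoidedBy aᵍ S) (map inj₁ xs ++ map inj₂ Eᵍ)
  compare [] S ind m =
    begin
      indPolyᶜ (avoidedBy aᶜ S) (map inj₂ Eᶜ) m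
        ≡⟨ indPoly-pendants aᶜ pendantᶜ (avoidedBy aᶜ S) Eᶜ m ⟩
      ([1+x]^ countB (avoidedBy aᶜ S ∘ inj₂) Eᶜ · one) m
        ≡⟨ cong (λ k → ([1+x]^ k · one) m) (balance S ind) ⟩
      ([1+x]^ (d + countB (avoidedBy aᵍ S ∘ inj₂) Eᵍ) · one) m
        ≡⟨ [1+x]^-+ d _ one m ⟩
      ([1+x]^ d · ([1+x]^ countB (avoidedBy aᵍ S ∘ inj₂) Eᵍ · one)) m
        ≡⟨ [1+x]^-cong d (λ i → sym (indPoly-pendants aᵍ pendantᵍ (avoidedBy aᵍ S) Eᵍ i)) m ⟩
      ([1+x]^ d · indPolyᵍ (avoidedBy aᵍ S) (map inj₂ Eᵍ)) m
    ∎
    where open ≡-Reasoning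
  compare (x ∷ xs) S ind m =
    trans (cong₂ _+_ (compare xs S ind m) (take-x m))
          (sym ([1+x]^-+ᴾ d (indPolyᵍ (avoidedBy aᵍ S) restᵍ) _ m))
    where
    restᶜ : List (A ⊎ Bᶜ)
    restᶜ = map inj₁ xs ++ map inj₂ Eᶜ
    restᵍ : List (A ⊎ Bᵍ)
    restᵍ = map inj₁ xs ++ map inj₂ Eᵍ
    -- x is allowed in both graphs or in neither; if taken, S grows to x ∷ S.
    take-x : (if avoidedBy aᶜ S (inj₁ x)
                then x· indPolyᶜ (avoidedBy aᶜ (x ∷ S)) restᶜ else 0ᴾ)
             ≗ [1+x]^ d · (if avoidedBy aᵍ S (inj₁ x)
                           then x· indPolyᵍ (avoidedBy aᵍ (x ∷ S)) restᵍ else 0ᴾ)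
    take-x rewrite avoidedᶜ-base S x | avoidedᵍ-base S x with all (λ s → not (b s x)) S in ok
    ... | true  = λ m → trans (x·-cong (compare xs (x ∷ S) (ok ∷ ind)) m)
                              (sym ([1+x]^-x· d _ m))
    ... | false = λ m → sym ([1+x]^-0ᴾ d m)

  compare-graphs : ∀ xs → indPolyᶜ (λ _ → true) (map inj₁ xs ++ map inj₂ Eᶜ)
                   ≗ [1+x]^ d · indPolyᵍ (λ _ → true) (map inj₁ xs ++ map inj₂ Eᵍ)
  compare-graphs xs = compare xs [] []

pathEdges : A → List A → List (A × A)
pathEdges x []       = []
pathEdges x (y ∷ ys) = (x , y) ∷ pathEdges y ys

-- Double counting on a path: every vertex lies on two edges, except that
-- each end lies on one.
path-degrees : ∀ {A : Set} (f : A → ℕ) x xs →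
  sumMap (λ e → f (proj₁ e) + f (proj₂ e)) (pathEdges x xs) + (f x + f (lastOf x xs))
  ≡ sumMap (λ v → f v + f v) (x ∷ xs)
path-degrees f x []       = sym (+-identityʳ (f x + f x))
path-degrees {A} f x (y ∷ ys) =
  begin
    (f x + f y) + E + (f x + f l)      ≡⟨ solve 4 (λ fx fy E fl → (fx :+ fy) :+ E :+ (fx :+ fl)
                                                   := (fx :+ fx) :+ (E :+ (fy :+ fl))) refl
                                                   (f x) (f y) E (f l) ⟩
    (f x + f x) + (E + (f y + f l))    ≡⟨ cong ((f x + f x) +_) (path-degrees f y ys) ⟩
    (f x + f x) + sumMap (λ v → f v + f v) (y ∷ ys)
  ∎
  where
  open ≡-Reasoning
  E : ℕ
  E = sumMap (λ e → f (proj₁ e) + f (proj₂ e)) (pathEdges y ys)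
  l : A
  l = lastOf y ys

at-last : ∀ (z : A) r → at (z ∷ r) (length r) ≡ just (lastOf z r)
at-last z []      = refl
at-last z (w ∷ r) = at-last w r

bit-∧ : ∀ a b → a ∨ b ≡ true → bit (b ∧ a) + 1 ≡ bit a + bit b
bit-∧ true  true  _ = refl
bit-∧ true  false _ = refl
bit-∧ false true  _ = refl

eqF-sym : ∀ {n} (u v : Fin n) → eqF u v ≡ eqF v u
eqF-sym u v with u ≟ v | v ≟ u
... | yes _   | yes _   = refl
... | no _    | no _    = refl
... | yes u≡v | no v≢u  = ⊥-elim (v≢u (sym u≡v))
... | no u≢v  | yes v≡u = ⊥-elim (u≢v (sym v≡u))

pendantsOf : ∀ {n} → List (Fin n) → List (Fin n × ℕ)
pendantsOf L = concat (map (λ v → (v , 0) ∷ (v , 1) ∷ []) L)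

weight : List A → ℕ
weight (_ ∷ []) = 0
weight xs       = length xs

module FreePendants (n : ℕ) (adj : Adj n) (symm : Symmetric adj) (irr : Irreflexive adj)
                    (S : List (Fin n)) (ind : Independent adj S) where

  outside : Fin n → Bool
  outside v = all (λ s → not (eqF v s)) S

  outsideM : Maybe (Fin n) → Bool
  outsideM nothing  = true
  outsideM (just v) = outside v

  twice : Fin n → ℕ
  twice v = bit (outside v) + bit (outside v)

  free : List (Fin n) → ℕ
  free vs = countB (λ j → all (λ s → not (attach vs j s)) S) (upTo (newCount vs))

  outside-∈ : ∀ {v} → outside v ≡ false → v ∈ S
  outside-∈ = go S
    where
    go : ∀ {v} T → all (λ s → not (eqF v s)) T ≡ false → v ∈ T
    go {v} (t ∷ T) out with v ≟ t
    ... | yes v≡t = here v≡t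
    ... | no _    = there (go T out)

  not-both : ∀ {b} → not b ≡ true → b ≡ true → ⊥
  not-both () refl

  no-edge-inside : ∀ {T u v} → Independent adj T → u ∈ T → v ∈ T → adj u v ≡ true → ⊥
  no-edge-inside {u = u} (_ ∷ _) (here refl) (here refl) e = not-both (cong not (irr u)) e
  no-edge-inside {u = u} {v} (ok ∷ _) (here refl) (there v∈) e =
    not-both (all-∈ _ ok v∈) (trans (symm v u) e)
  no-edge-inside {u = u} {v} (ok ∷ _) (there u∈) (here refl) e =
    not-both (all-∈ _ ok u∈) e
  no-edge-inside (_ ∷ ind') (there u∈) (there v∈) e = no-edge-inside ind' u∈ v∈ e

  edge-outside : ∀ {u v} → adj u v ≡ true → outside u ∨ outside v ≡ true
  edge-outside {u} {v} e with outside u in ou | outside v in ov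
  ... | true  | _     = refl
  ... | false | true  = refl
  ... | false | false = ⊥-elim (no-edge-inside ind (outside-∈ ou) (outside-∈ ov) e)

  edge-bits : ∀ {u v} → adj u v ≡ true →
              bit (outside v ∧ outside u) + 1 ≡ bit (outside u) + bit (outside v)
  edge-bits {u} {v} e = bit-∧ (outside u) (outside v) (edge-outside e)

  edgeFree : Fin n × Fin n → ℕ
  edgeFree e = bit (outside (proj₂ e) ∧ outside (proj₁ e))

  path-balance : ∀ x xs → PathIn adj (x ∷ xs) →
    sumMap edgeFree (pathEdges x xs) + length xs
    ≡ sumMap (λ e → bit (outside (proj₁ e)) + bit (outside (proj₂ e))) (pathEdges x xs)
  path-balance x []       _          = refl
  path-balance x (y ∷ ys) (xy , pth) =
    trans (solve 3 (λ t P k → (t :+ P) :+ (con 1 :+ k) := (t :+ con 1) :+ (P :+ k)) refl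
                   (edgeFree (x , y)) (sumMap edgeFree (pathEdges y ys)) (length ys))
          (cong₂ _+_ (edge-bits xy) (path-balance y ys pth))

  avoids-at : ∀ mv → all (λ s → not (maybe (λ u → eqF u s) false mv)) S ≡ outsideM mv
  avoids-at nothing  = all-true S
  avoids-at (just u) = refl

  -- the new vertices w₂, …, w_s of a proper cycle sit on its path edges
  path-free : ∀ (g : ℕ → ℕ) x xs →
              (∀ j → g j ≡ bit (outsideM (at (x ∷ xs) (suc j)) ∧ outsideM (at (x ∷ xs) j))) →
              sum (applyUpTo g (length xs)) ≡ sumMap edgeFree (pathEdges x xs)
  path-free g x []       _ = refl
  path-free g x (y ∷ ys) h = cong₂ _+_ (h 0) (path-free (g ∘ suc) y ys (h ∘ suc))

  -- free new vertices of a proper cycle: w₁ on the closing edge, the rest on the path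
  cycle-free : ∀ x y z r →
    free (x ∷ y ∷ z ∷ r)
    ≡ bit (outside x ∧ outside (lastOf z r)) + sumMap edgeFree (pathEdges x (y ∷ z ∷ r))
  cycle-free x y z r =
    trans (countB-as-sum p (upTo (length vs)))
          (cong₂ _+_ (cong bit closing)
                     (trans (cong sum (map-applyUpTo suc (bit ∘ p) (length (y ∷ z ∷ r))))
                            (path-free (bit ∘ p ∘ suc) x (y ∷ z ∷ r) (cong bit ∘ on-path))))
    where
    vs : List (Fin n)
    vs = x ∷ y ∷ z ∷ r
    p : ℕ → Bool
    p j = all (λ s → not (attach vs j s)) S
    closing : p 0 ≡ outside x ∧ outside (lastOf z r)
    closing = trans (all-nor _ _ S)
                    (cong (outside x ∧_) (trans (avoids-at (at vs (length vs ∸ 1)))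
                                                (cong outsideM (at-last z r))))
    on-path : ∀ j → p (suc j) ≡ outsideM (at vs (suc j)) ∧ outsideM (at vs j)
    on-path j = trans (all-nor _ _ S) (cong₂ _∧_ (avoids-at (at vs (suc j))) (avoids-at (at vs j)))

  component-balance : ∀ vs → IsComponent adj vs → sumMap twice vs ≡ weight vs + free vs
  component-balance (x ∷ []) _ =
    trans (+-assoc (bit (outside x)) (bit (outside x)) 0)
          (sym (countB-as-sum (λ j → outside x) (upTo 2)))
  component-balance (x ∷ y ∷ []) xy =
    begin
      twice x + (twice y + 0)
        ≡⟨ solve 2 (λ a b → (a :+ a) :+ ((b :+ b) :+ con 0) := (b :+ a) :+ (b :+ a)) refl
                   (bit (outside x)) (bit (outside y)) ⟩
      (bit (outside y) + bit (outside x)) + (bit (outside y) + bit (outside x))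
        ≡⟨ cong (λ c → c + c) (sym (edge-bits (trans (symm y x) xy))) ⟩
      (t + 1) + (t + 1)
        ≡⟨ solve 1 (λ t → (t :+ con 1) :+ (t :+ con 1) := con 2 :+ (t :+ (t :+ con 0))) refl t ⟩
      2 + (t + (t + 0))
        ≡⟨ cong (λ c → 2 + (bit c + (bit c + 0))) (sym (all-nor (eqF x) (eqF y) S)) ⟩
      2 + sumMap (bit ∘ p) (upTo 2)
        ≡⟨ cong (2 +_) (sym (countB-as-sum p (upTo 2))) ⟩
      2 + free (x ∷ y ∷ [])
    ∎
    where
    open ≡-Reasoning
    t : ℕ
    t = bit (outside x ∧ outside y)
    p : ℕ → Bool
    p j = all (λ s → not (attach (x ∷ y ∷ []) j s)) S
  component-balance (x ∷ y ∷ z ∷ r) (pth , lx) =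
    begin
      sumMap twice vs
        ≡⟨ sym (path-degrees (bit ∘ outside) x (y ∷ z ∷ r)) ⟩
      D + (bit (outside x) + bit (outside l))
        ≡⟨ cong₂ _+_ (sym (path-balance x (y ∷ z ∷ r) pth))
                     (trans (+-comm (bit (outside x)) _) (sym (edge-bits lx))) ⟩
      (P + k) + (c + 1)
        ≡⟨ solve 3 (λ P k c → (P :+ k) :+ (c :+ con 1) := (con 1 :+ k) :+ (c :+ P)) refl P k c ⟩
      suc k + (c + P)
        ≡⟨ cong (suc k +_) (sym (cycle-free x y z r)) ⟩
      weight vs + free vs
    ∎
    where
    open ≡-Reasoning
    vs : List (Fin n)
    vs = x ∷ y ∷ z ∷ r
    l : Fin n
    l = lastOf z r
    k c P D : ℕ
    k = length (y ∷ z ∷ r)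
    c = bit (outside x ∧ outside l)
    P = sumMap edgeFree (pathEdges x (y ∷ z ∷ r))
    D = sumMap (λ e → bit (outside (proj₁ e)) + bit (outside (proj₂ e))) (pathEdges x (y ∷ z ∷ r))

  cover-balance : ∀ Γ → AllComp adj Γ → sumMap (sumMap twice) Γ ≡ sumMap weight Γ + sumMap free Γ
  cover-balance []       []         = refl
  cover-balance (c ∷ cs) (cc ∷ ccs) =
    trans (cong₂ _+_ (component-balance c cc) (cover-balance cs ccs))
          (+-interchange (weight c) (free c) (sumMap weight cs) (sumMap free cs))

  pendantFree : Fin n × ℕ → Bool
  pendantFree w = all (λ s → not (eqF s (proj₁ w))) S

  corona-free : countB pendantFree (pendantsOf (allFin n)) ≡ sumMap twice (allFin n)
  corona-free =
    trans (countB-concatMap pendantFree (λ v → (v , 0) ∷ (v , 1) ∷ []) (allFin n))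
          (sumMap-cong pendants-of (allFin n))
    where
    pendants-of : ∀ v → countB pendantFree ((v , 0) ∷ (v , 1) ∷ []) ≡ twice v
    pendants-of v =
      trans (countB-as-sum pendantFree ((v , 0) ∷ (v , 1) ∷ []))
            (trans (cong (λ c → bit c + (bit c + 0)) (all-cong (λ s → cong not (eqF-sym s v)) S))
                   (cong (bit (outside v) +_) (+-identityʳ (bit (outside v)))))

  Γ-free : ∀ Γ → countB (λ w → all (λ s → not (attachC Γ w s)) S) (newVerts 0 Γ) ≡ sumMap free Γ
  Γ-free Γ = from 0 Γ (λ i → cong (at Γ) (+-identityʳ i))
    where
    at-j : ℕ → Maybe (List (Fin n)) → Bool
    at-j j mc = all (λ s → not (maybe (λ vs → attach vs j s) false mc)) S
    -- the components cs start at position c of Γ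
    from : ∀ c cs → (∀ i → at Γ (i + c) ≡ at cs i) →
           countB (λ w → all (λ s → not (attachC Γ w s)) S) (newVerts c cs) ≡ sumMap free cs
    from c []        _ = refl
    from c (vs ∷ cs) h =
      trans (countB-++ _ (map (λ j → (c , j)) (upTo (newCount vs))) (newVerts (suc c) cs))
            (cong₂ _+_ (trans (countB-map _ (λ j → (c , j)) (upTo (newCount vs)))
                                              (countB-cong (λ j → cong (at-j j) (h 0)) (upTo (newCount vs))))
                       (from (suc c) cs (λ i → trans (cong (at Γ) (+-suc i c)) (h (suc i)))))

cover-weight : ∀ {n} (Γ : List (List (Fin n))) → concat Γ ↭ allFin n →
               n ∸ vertexCycles Γ ≡ sumMap weight Γ
cover-weight {n} Γ spans =
  trans (cong (_∸ vertexCycles Γ) n≡)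
        (m+n∸n≡m (sumMap weight Γ) (vertexCycles Γ))
  where
  lengths : ∀ (cs : List (List (Fin n))) → length (concat cs) ≡ sumMap weight cs + vertexCycles cs
  lengths []                  = refl
  lengths ([] ∷ cs)           = lengths cs
  lengths ((x ∷ []) ∷ cs)     = trans (cong suc (lengths cs)) (sym (+-suc (sumMap weight cs) (vertexCycles cs)))
  lengths ((x ∷ y ∷ r) ∷ cs)  =
    trans (length-++ (x ∷ y ∷ r)) (trans (cong (length (x ∷ y ∷ r) +_) (lengths cs))
                                         (sym (+-assoc (length (x ∷ y ∷ r)) _ _)))
  n≡ : n ≡ sumMap weight Γ + vertexCycles Γ
  n≡ = trans (sym (length-tabulate id)) (trans (sym (↭-length spans)) (lengths Γ))

corona-verts : ∀ {n} (L : List (Fin n)) →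
  concat (map (λ v → inj₂ {A = Fin n} (v , 0) ∷ inj₂ (v , 1) ∷ []) L) ≡ map inj₂ (pendantsOf L)
corona-verts []      = refl
corona-verts (v ∷ L) = cong (λ t → inj₂ (v , 0) ∷ inj₂ (v , 1) ∷ t) (corona-verts L)

pendant-balance : ∀ n adj → Symmetric adj → Irreflexive adj → ∀ Γ → IsCycleCover n adj Γ →
  ∀ S → Independent adj S →
  countB (avoidedBy (FinGraph.adj (corona2K1 n adj)) S ∘ inj₂) (pendantsOf (allFin n))
  ≡ (n ∸ vertexCycles Γ) + countB (avoidedBy (FinGraph.adj (ΓG n adj Γ)) S ∘ inj₂) (newVerts 0 Γ)
pendant-balance n adj symm irr Γ (components , spans) S ind =
  begin
    countB pendantFree (pendantsOf (allFin n))  ≡⟨ corona-free ⟩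
    sumMap twice (allFin n)                     ≡⟨ sumMap-↭ twice (↭-sym spans) ⟩
    sumMap twice (concat Γ)                     ≡⟨ sumMap-concat twice Γ ⟩
    sumMap (sumMap twice) Γ                     ≡⟨ cover-balance Γ components ⟩
    sumMap weight Γ + sumMap free Γ
      ≡⟨ cong₂ _+_ (sym (cover-weight Γ spans)) (sym (Γ-free Γ)) ⟩
    (n ∸ vertexCycles Γ) + countB (λ w → all (λ s → not (attachC Γ w s)) S) (newVerts 0 Γ)
  ∎
  where
  open ≡-Reasoning
  open FreePendants n adj symm irr S ind

theorem10 : (n : ℕ) (adj : Adj n) → Symmetric adj → Irreflexive adj →
            (Γ : List (List (Fin n))) → IsCycleCover n adj Γ →
            ∀ m → I (corona2K1 n adj) m
                  ≡ ((onePlusX ^ᴾ (n ∸ vertexCycles Γ)) ⊛ I (ΓG n adj Γ)) m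
theorem10 n adj symm irr Γ cover m =
  begin
    I (corona2K1 n adj) m
      ≡⟨ I-as-indPoly (corona2K1 n adj) m ⟩
    indPolyᶜ (λ _ → true) (map inj₁ (allFin n) ++ concat (map (λ v → inj₂ (v , 0) ∷ inj₂ (v , 1) ∷ []) (allFin n))) m
      ≡⟨ cong (λ t → indPolyᶜ (λ _ → true) (map inj₁ (allFin n) ++ t) m) (corona-verts (allFin n)) ⟩
    indPolyᶜ (λ _ → true) (map inj₁ (allFin n) ++ map inj₂ (pendantsOf (allFin n))) m
      ≡⟨ compare-graphs (allFin n) m ⟩
    ([1+x]^ d · indPolyᵍ (λ _ → true) (FinGraph.verts (ΓG n adj Γ))) m
      ≡⟨ [1+x]^-cong d (λ i → sym (I-as-indPoly (ΓG n adj Γ) i)) m ⟩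
    ([1+x]^ d · I (ΓG n adj Γ)) m
      ≡⟨ sym (power-⊛ d (I (ΓG n adj Γ)) m) ⟩
    ((onePlusX ^ᴾ d) ⊛ I (ΓG n adj Γ)) m
  ∎
  where
  open ≡-Reasoning
  d : ℕ
  d = n ∸ vertexCycles Γ
  aᶜ : Fin n ⊎ (Fin n × ℕ) → Fin n ⊎ (Fin n × ℕ) → Bool
  aᶜ = FinGraph.adj (corona2K1 n adj)
  aᵍ : Fin n ⊎ (ℕ × ℕ) → Fin n ⊎ (ℕ × ℕ) → Bool
  aᵍ = FinGraph.adj (ΓG n adj Γ)
  open Restricted aᶜ using () renaming (indPoly to indPolyᶜ)
  open Restricted aᵍ using () renaming (indPoly to indPolyᵍ)
  open Comparison adj aᶜ aᵍ (λ _ _ → refl) (λ _ _ → refl) (λ _ _ → refl) (λ _ _ → refl)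
                  d (pendantsOf (allFin n)) (newVerts 0 Γ) (pendant-balance n adj symm irr Γ cover)
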